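{- There exists a one-pass streaming $2$-approximation algorithm for the unweighted cycle augmentation problem whose total memory is $O(n)$ edges.
   Context: Cycle augmentation problem: given a cycle $C$ on $n$ vertices $V$ (which is stored/known in advance) and a set of links $L\subseteq\binom{V}{2}$ arriving one by one in an arbitrary order in a stream, find a subset $S\subseteq L$ such that $(V, C\cup S)$ is $3$-edge-connected; in the unweighted version the goal is to minimize $|S|$. A $2$-approximation outputs a feasible $S$ of size at most twice the optimum. -}

module Defs where

open import Data.Nat using (ℕ; zero; suc; _+_; _*_; _≤_; _<_; NonZero)
open import Data.Nat.DivMod using (_mod_)
open import Data.Fin using (Fin; toℕ)
open import Data.Fin.Subset using (Subset; Nonempty; ∁)
open import Data.Vec using (lookup)
open import Data.Bool using (Bool; true; false; _xor_)
open import Data.List using (List; []; _∷_; map; length; _++_; foldl; allFin)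
open import Data.List.Relation.Unary.All using (All)
open import Data.List.Membership.Propositional using (_∈_)
open import Data.Product using (Σ; _×_; _,_; proj₁)

-- A link on vertex set Fin n: an unordered pair {u,v}, u ≠ v,
-- represented canonically as (u , v) with u < v.
Link : ℕ → Set
Link n = Σ (Fin n × Fin n) (λ p → toℕ (proj₁ p) < toℕ (Data.Product.proj₂ p))

Edge : ℕ → Set
Edge n = Fin n × Fin n

linkEdge : ∀ {n} → Link n → Edge n
linkEdge = proj₁

next : ∀ {n} → Fin n → Fin n
next {suc m} i = suc (toℕ i) mod (suc m)

cycleEdges : (n : ℕ) → List (Edge n)
cycleEdges n = map (λ i → i , next i) (allFin n)

crossing : ∀ {n} → Subset n → List (Edge n) → ℕ
crossing X [] = 0
crossing X ((u , v) ∷ es) with lookup X u xor lookup X v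
... | true  = suc (crossing X es)
... | false = crossing X es

EdgeConnected : (k : ℕ) → (n : ℕ) → List (Edge n) → Set
EdgeConnected k n es =
  (X : Subset n) → Nonempty X → Nonempty (∁ X) → k ≤ crossing X es

Feasible : (n : ℕ) → List (Link n) → Set
Feasible n S = EdgeConnected 3 n (cycleEdges n ++ map linkEdge S)

_⊆ˡ_ : ∀ {A : Set} → List A → List A → Set
xs ⊆ˡ ys = All (λ x → x ∈ ys) xs

-- One-pass streaming algorithm. The cycle (i.e. n) is known in advance.
-- Memory is a list of edge-sized cells (pairs of vertex identifiers).
Memory : ℕ → Set
Memory n = List (Fin n × Fin n)

record StreamAlg : Set where
  field
    init   : (n : ℕ) → Memory n
    step   : (n : ℕ) → Memory n → Link n → Memory n
    output : (n : ℕ) → Memory n → List (Link n)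

open StreamAlg public

run : StreamAlg → (n : ℕ) → List (Link n) → Memory n
run A n ls = foldl (step A n) (init A n) ls

states : StreamAlg → (n : ℕ) → Memory n → List (Link n) → List (Memory n)
states A n m [] = m ∷ []
states A n m (l ∷ ls) = m ∷ states A n (step A n m l) ls

MemoryBound : StreamAlg → ℕ → (n : ℕ) → List (Link n) → Set
MemoryBound A c n ls = All (λ m → length m ≤ c * n) (states A n (init A n) ls)

-- The algorithm keeps a link exactly when it joins two components of the
-- links kept so far, detected with a table of n component representatives
-- (union–find).  The kept links F form a spanning forest of (V, L), so
-- |F| ≤ n and the memory never exceeds 2n cells.
-- F is feasible when L is: the cycle crosses every proper cut twice, and a cut
-- crossed by a link of L is crossed by F as well, because the endpoints of that
-- link lie in one tree of F.
-- F is a 2-approximation: a feasible S must cover every vertex v, since the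
-- cycle crosses the cut {v} only twice; hence 2|S| ≥ n ≥ |F|.

module Submission where

open import Defs
open import Data.Nat using (ℕ; zero; suc; _+_; _*_; _≤_; _<_; z≤n; s≤s; _<?_)
open import Data.Nat.Properties
open import Data.Nat.DivMod using (_%_; m<n⇒m%n≡m; n%n≡0)
open import Data.Bool using (Bool; true; false; _xor_; T)
open import Data.Bool.Properties using (xor-same; T-≡)
open import Data.Fin using (Fin; zero; suc; toℕ; inject₁; fromℕ; punchIn)
open import Data.Fin.Properties
  using (toℕ-injective; toℕ<n; toℕ-fromℕ<; toℕ-inject₁; toℕ-fromℕ; fromℕ≢inject₁; inject₁-injective; ≤fromℕ; punchInᵢ≢i)
  renaming (_≟_ to _≟ᶠ_)
open import Data.Fin.Subset using (Subset; Nonempty; ∁; ⁅_⁆; ∣_∣; _⊂_)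
  renaming (_∈_ to _∈ₛ_; _∉_ to _∉ₛ_)
open import Data.Fin.Subset.Properties
  using (p⊂q⇒∣p∣<∣q∣; ∣p∣≤n; x∈⁅x⁆; x∈⁅y⁆⇒x≡y; x∉p⇒x∈∁p; x∈∁p⇒x∉p)
open import Data.Vec using (Vec; lookup; tabulate)
import Data.Vec as Vec
open import Data.Vec.Properties
  using ([]=⇒lookup; lookup⇒[]=; lookup∘tabulate; tabulate∘lookup; tabulate-cong; lookup-map; lookup-allFin)
open import Data.List using (List; []; _∷_; map; length; _++_; filter; allFin; drop; foldl; mapMaybe)
open import Data.List.Properties using (mapMaybe-map-retract; length-++; length-removeAt′; length-map; length-tabulate)
open import Data.List.Relation.Unary.Any using (here; there; _─_)
open import Data.List.Relation.Unary.All as All using (All; []; _∷_)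
open import Data.List.Relation.Unary.AllPairs using ([]; _∷_)
open import Data.List.Relation.Unary.Unique.Propositional using (Unique)
open import Data.List.Relation.Unary.Unique.Propositional.Properties as Unique using (allFin⁺)
open import Data.List.Membership.Propositional using (_∈_)
open import Data.List.Membership.Propositional.Properties
  using (∈-allFin; ∈-map⁺; ∈-map⁻; ∈-filter⁺; ∈-filter⁻; ∈-++⁺ˡ; ∈-++⁺ʳ)
open import Data.List.Relation.Binary.Subset.Propositional using (_⊆_)
open import Data.Product using (Σ; _×_; _,_; proj₁; proj₂; ∃)
open import Data.Sum using (_⊎_; inj₁; inj₂)
open import Data.Empty using (⊥-elim)
open import Data.Maybe using (Maybe; just; nothing)
open import Function using (_∘_; Equivalence)
open import Relation.Nullary using (¬_; Dec; yes; no)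
open import Relation.Nullary.Decidable using (T?; does; dec-true)
open import Relation.Binary.PropositionalEquality

private
  variable
    A : Set
    n m : ℕ

∈-─ : ∀ {x y : A} xs (x∈xs : x ∈ xs) → y ∈ xs → y ≢ x → y ∈ (xs ─ x∈xs)
∈-─ (_ ∷ _)  (here refl) (here refl)  y≢x = ⊥-elim (y≢x refl)
∈-─ (_ ∷ _)  (here refl) (there y∈xs) _   = y∈xs
∈-─ (_ ∷ xs) (there _)   (here refl)  _   = here refl
∈-─ (_ ∷ xs) (there x∈xs) (there y∈xs) y≢x = there (∈-─ xs x∈xs y∈xs y≢x)

Unique∧⊆⇒length≤ : {xs ys : List A} → Unique xs → xs ⊆ ys → length xs ≤ length ys
Unique∧⊆⇒length≤ {xs = []} _ _ = z≤n
Unique∧⊆⇒length≤ {xs = x ∷ xs} {ys} (x∉xs ∷ uxs) xs⊆ys = begin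
  suc (length xs)               ≤⟨ s≤s (Unique∧⊆⇒length≤ uxs xs⊆ys─x) ⟩
  suc (length (ys ─ x∈ys))      ≡⟨ sym (length-removeAt′ ys _) ⟩
  length ys                     ∎
  where
  open ≤-Reasoning
  x∈ys = xs⊆ys (here refl)
  xs⊆ys─x : xs ⊆ (ys ─ x∈ys)
  xs⊆ys─x y∈xs = ∈-─ ys x∈ys (xs⊆ys (there y∈xs)) λ { refl → All.lookup x∉xs y∈xs refl }

drop-++ : (xs ys : List A) → drop (length xs) (xs ++ ys) ≡ ys
drop-++ []       ys = refl
drop-++ (x ∷ xs) ys = drop-++ xs ys

xor-≢ : {a b : Bool} → a ≢ b → T (a xor b)
xor-≢ {true}  {true}  a≢b = ⊥-elim (a≢b refl)
xor-≢ {true}  {false} _   = _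
xor-≢ {false} {true}  _   = _
xor-≢ {false} {false} a≢b = ⊥-elim (a≢b refl)

xor-≡ : {a b : Bool} → a ≡ b → ¬ T (a xor b)
xor-≡ {a} refl = subst T (xor-same a)

xor⇒⊎ : {a b : Bool} → T (a xor b) → T a ⊎ T b
xor⇒⊎ {true}  _ = inj₁ _
xor⇒⊎ {false} t = inj₂ t

xor≡false⇒≡ : {a b : Bool} → a xor b ≡ false → a ≡ b
xor≡false⇒≡ {true}  {true}  _ = refl
xor≡false⇒≡ {false} {false} _ = refl

cuts : Subset n → Edge n → Bool
cuts X (u , v) = lookup X u xor lookup X v

crossingEdges : Subset n → List (Edge n) → List (Edge n)
crossingEdges X = filter (T? ∘ cuts X)

crossing≡length : (X : Subset n) (es : List (Edge n)) → crossing X es ≡ length (crossingEdges X es)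
crossing≡length X [] = refl
crossing≡length X ((u , v) ∷ es) with lookup X u xor lookup X v
... | true  = cong suc (crossing≡length X es)
... | false = crossing≡length X es

crossing-++ : (X : Subset n) (es fs : List (Edge n)) → crossing X (es ++ fs) ≡ crossing X es + crossing X fs
crossing-++ X [] fs = refl
crossing-++ X ((u , v) ∷ es) fs with lookup X u xor lookup X v
... | true  = cong suc (crossing-++ X es fs)
... | false = crossing-++ X es fs

crossing≥2 : (X : Subset n) {e f : Edge n} {es : List (Edge n)} → e ∈ es → f ∈ es → e ≢ f →
             T (cuts X e) → T (cuts X f) → 2 ≤ crossing X es
crossing≥2 X {e} {f} {es} e∈es f∈es e≢f e-cuts f-cuts =
  subst (2 ≤_) (sym (crossing≡length X es)) (Unique∧⊆⇒length≤ unique pair⊆)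
  where
  unique : Unique (e ∷ f ∷ [])
  unique = (e≢f ∷ []) ∷ [] ∷ []
  pair⊆ : (e ∷ f ∷ []) ⊆ crossingEdges X es
  pair⊆ (here refl)         = ∈-filter⁺ (T? ∘ cuts X) e∈es e-cuts
  pair⊆ (there (here refl)) = ∈-filter⁺ (T? ∘ cuts X) f∈es f-cuts

crossing≥1⇒∃ : (X : Subset n) (es : List (Edge n)) → 1 ≤ crossing X es → ∃ λ e → e ∈ es × T (cuts X e)
crossing≥1⇒∃ X es 1≤crossing with crossingEdges X es in eq | subst (1 ≤_) (crossing≡length X es) 1≤crossing
... | e ∷ _ | _ = e , ∈-filter⁻ (T? ∘ cuts X) (subst (e ∈_) (sym eq) (here refl))

crossing-∷≡0 : (X : Subset n) ((u , v) : Edge n) (es : List (Edge n)) → crossing X ((u , v) ∷ es) ≡ 0 →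
               lookup X u ≡ lookup X v × crossing X es ≡ 0
crossing-∷≡0 X (u , v) es no-crossing with lookup X u xor lookup X v in uv
... | false = xor≡false⇒≡ uv , no-crossing

next-inject₁ : (j : Fin m) → next {suc m} (inject₁ j) ≡ suc j
next-inject₁ {m} j = toℕ-injective (begin
  toℕ (next (inject₁ j))       ≡⟨ toℕ-fromℕ< _ ⟩
  suc (toℕ (inject₁ j)) % suc m ≡⟨ cong (λ k → suc k % suc m) (toℕ-inject₁ j) ⟩
  suc (toℕ j) % suc m           ≡⟨ m<n⇒m%n≡m (s≤s (toℕ<n j)) ⟩
  suc (toℕ j)                   ∎)
  where open ≡-Reasoning

next-fromℕ : ∀ m → next (fromℕ m) ≡ zero
next-fromℕ m = toℕ-injective (begin
  toℕ (next (fromℕ m))       ≡⟨ toℕ-fromℕ< _ ⟩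
  suc (toℕ (fromℕ m)) % suc m ≡⟨ cong (λ k → suc k % suc m) (toℕ-fromℕ m) ⟩
  suc m % suc m               ≡⟨ n%n≡0 (suc m) ⟩
  0                           ∎)
  where open ≡-Reasoning

inject₁-or-fromℕ : (i : Fin (suc m)) → (∃ λ j → i ≡ inject₁ j) ⊎ i ≡ fromℕ m
inject₁-or-fromℕ {zero}  zero    = inj₂ refl
inject₁-or-fromℕ {suc m} zero    = inj₁ (zero , refl)
inject₁-or-fromℕ {suc m} (suc i) with inject₁-or-fromℕ i
... | inj₁ (j , refl) = inj₁ (suc j , refl)
... | inj₂ refl       = inj₂ refl

prev : Fin (suc m) → Fin (suc m)
prev {m} zero = fromℕ m
prev (suc j)  = inject₁ j

prev-next : (i : Fin (suc m)) → prev (next i) ≡ i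
prev-next {m} i with inject₁-or-fromℕ i
... | inj₁ (j , refl) = cong prev (next-inject₁ j)
... | inj₂ refl       = cong prev (next-fromℕ m)

change-between : (f : Fin (suc m) → Bool) (i j : Fin (suc m)) → toℕ i ≤ toℕ j → f i ≢ f j →
                 ∃ λ (k : Fin m) → toℕ i ≤ toℕ k × toℕ k < toℕ j × f (inject₁ k) ≢ f (suc k)
change-between f zero zero _ fi≢fj = ⊥-elim (fi≢fj refl)
change-between {suc m} f zero (suc j) _ f0≢fj with f zero Data.Bool.≟ f (suc zero)
... | no f0≢f1 = zero , z≤n , s≤s z≤n , f0≢f1
... | yes f0≡f1 with change-between (f ∘ suc) zero j z≤n (λ e → f0≢fj (trans f0≡f1 e))
...   | k , _ , k<j , change = suc k , z≤n , s≤s k<j , change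
change-between {suc m} f (suc i) (suc j) (s≤s i≤j) fi≢fj with change-between (f ∘ suc) i j i≤j fi≢fj
... | k , i≤k , k<j , change = suc k , s≤s i≤k , s≤s k<j , change

lookup-∁ : (X : Subset n) {y : Fin n} → y ∈ₛ ∁ X → lookup X y ≡ false
lookup-∁ X {y} y∈∁X with lookup X y in eq
... | false = refl
... | true  = ⊥-elim (x∈∁p⇒x∉p y∈∁X (lookup⇒[]= y X eq))

nonconstant : (X : Subset n) → Nonempty X → Nonempty (∁ X) → ∀ i → ∃ λ k → lookup X i ≢ lookup X k
nonconstant X (x , x∈X) (y , y∈∁X) i with lookup X i
... | true  = y , λ e → subst T (trans e (lookup-∁ X y∈∁X)) _
... | false = x , λ e → subst T (trans (sym ([]=⇒lookup x∈X)) (sym e)) _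

cycle-∈ : (i : Fin n) → (i , next i) ∈ cycleEdges n
cycle-∈ i = ∈-map⁺ _ (∈-allFin i)

change-cuts : (X : Subset (suc m)) (k : Fin m) → lookup X (inject₁ k) ≢ lookup X (suc k) →
              T (cuts X (inject₁ k , next (inject₁ k)))
change-cuts X k change rewrite next-inject₁ k = xor-≢ change

cycle-crossing≥2-ends-differ : (X : Subset (suc m)) → lookup X zero ≢ lookup X (fromℕ m) →
                        2 ≤ crossing X (cycleEdges (suc m))
cycle-crossing≥2-ends-differ {m} X first≢last with change-between (lookup X) zero (fromℕ m) z≤n first≢last
... | k , _ , _ , change =
  crossing≥2 X (cycle-∈ (inject₁ k)) (cycle-∈ (fromℕ m)) (λ e → fromℕ≢inject₁ (sym (cong proj₁ e)))
             (change-cuts X k change) wrap-cuts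
  where
  wrap-cuts : T (cuts X (fromℕ m , next (fromℕ m)))
  wrap-cuts rewrite next-fromℕ m = xor-≢ (first≢last ∘ sym)

cycle-crossing≥2-ends-agree : (X : Subset (suc m)) (j : Fin (suc m)) →
                         lookup X zero ≡ lookup X (fromℕ m) → lookup X zero ≢ lookup X j →
                         2 ≤ crossing X (cycleEdges (suc m))
cycle-crossing≥2-ends-agree {m} X j first≡last first≢j
  with change-between (lookup X) zero j z≤n first≢j
     | change-between (lookup X) j (fromℕ m) (≤fromℕ j) (λ e → first≢j (trans first≡last (sym e)))
... | k₁ , _ , k₁<j , change₁ | k₂ , j≤k₂ , _ , change₂ =
  crossing≥2 X (cycle-∈ (inject₁ k₁)) (cycle-∈ (inject₁ k₂)) k₁≢k₂
             (change-cuts X k₁ change₁) (change-cuts X k₂ change₂)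
  where
  k₁≢k₂ : (inject₁ k₁ , next (inject₁ k₁)) ≢ (inject₁ k₂ , next (inject₁ k₂))
  k₁≢k₂ e = <-irrefl (cong toℕ (inject₁-injective (cong proj₁ e))) (<-≤-trans k₁<j j≤k₂)

cycle-crossing≥2 : (X : Subset (suc m)) → Nonempty X → Nonempty (∁ X) → 2 ≤ crossing X (cycleEdges (suc m))
cycle-crossing≥2 {m} X ne-X ne-∁X with lookup X zero Data.Bool.≟ lookup X (fromℕ m)
... | no first≢last = cycle-crossing≥2-ends-differ X first≢last
... | yes first≡last =
  let j , first≢j = nonconstant X ne-X ne-∁X zero in cycle-crossing≥2-ends-agree X j first≡last first≢j

T-lookup-⁅⁆ : (v w : Fin n) → T (lookup ⁅ v ⁆ w) → w ≡ v
T-lookup-⁅⁆ v w t = x∈⁅y⁆⇒x≡y v (lookup⇒[]= w ⁅ v ⁆ (Equivalence.to T-≡ t))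

cycleEdges-unique : ∀ n → Unique (cycleEdges n)
cycleEdges-unique n = Unique.map⁺ (cong proj₁) (allFin⁺ n)

cycle-crossing-⁅⁆≤2 : (v : Fin (suc m)) → crossing ⁅ v ⁆ (cycleEdges (suc m)) ≤ 2
cycle-crossing-⁅⁆≤2 {m} v = subst (_≤ 2) (sym (crossing≡length ⁅ v ⁆ (cycleEdges (suc m))))
  (Unique∧⊆⇒length≤ (Unique.filter⁺ (T? ∘ cuts ⁅ v ⁆) (cycleEdges-unique (suc m))) ⊆-edges-at-v)
  where
  ⊆-edges-at-v : crossingEdges ⁅ v ⁆ (cycleEdges (suc m)) ⊆ ((v , next v) ∷ (prev v , next (prev v)) ∷ [])
  ⊆-edges-at-v e∈ with ∈-filter⁻ (T? ∘ cuts ⁅ v ⁆) e∈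
  ... | e∈cycle , e-cuts with ∈-map⁻ _ e∈cycle
  ... | i , _ , refl with xor⇒⊎ e-cuts
  ... | inj₁ t rewrite T-lookup-⁅⁆ v i t = here refl
  ... | inj₂ t = there (here (cong (λ j → j , next j) (begin
    i             ≡⟨ sym (prev-next i) ⟩
    prev (next i) ≡⟨ cong prev (T-lookup-⁅⁆ v (next i) t) ⟩
    prev v        ∎)))
    where open ≡-Reasoning

-- Feasible augmentations

edges : List (Link n) → List (Edge n)
edges = map linkEdge

endpoints : List (Link n) → List (Fin n)
endpoints S = map (proj₁ ∘ linkEdge) S ++ map (proj₂ ∘ linkEdge) S

length-endpoints : (S : List (Link n)) → length (endpoints S) ≡ 2 * length S
length-endpoints S = begin
  length (endpoints S)
    ≡⟨ length-++ (map (proj₁ ∘ linkEdge) S) ⟩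
  length (map (proj₁ ∘ linkEdge) S) + length (map (proj₂ ∘ linkEdge) S)
    ≡⟨ cong₂ _+_ (length-map _ S) (length-map _ S) ⟩
  length S + length S
    ≡⟨ cong (length S +_) (sym (+-identityʳ _)) ⟩
  2 * length S
    ∎
  where open ≡-Reasoning

feasible⇒crossing-⁅⁆≥1 : {S : List (Link (suc (suc m)))} → Feasible _ S → (v : Fin (suc (suc m))) →
                         1 ≤ crossing ⁅ v ⁆ (edges S)
feasible⇒crossing-⁅⁆≥1 {m} {S} feasible v = +-cancelˡ-≤ 2 1 _ (begin
  3                                                       ≤⟨ feasible ⁅ v ⁆ (v , x∈⁅x⁆ v) other-vertex ⟩
  crossing ⁅ v ⁆ (cycleEdges _ ++ edges S)                ≡⟨ crossing-++ ⁅ v ⁆ (cycleEdges _) (edges S) ⟩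
  crossing ⁅ v ⁆ (cycleEdges _) + crossing ⁅ v ⁆ (edges S) ≤⟨ +-monoˡ-≤ _ (cycle-crossing-⁅⁆≤2 v) ⟩
  2 + crossing ⁅ v ⁆ (edges S)                            ∎)
  where
  open ≤-Reasoning
  other-vertex : Nonempty (∁ ⁅ v ⁆)
  other-vertex = punchIn v zero , x∉p⇒x∈∁p (punchInᵢ≢i v zero ∘ x∈⁅y⁆⇒x≡y v)

feasible⇒covers : {S : List (Link (suc (suc m)))} → Feasible _ S → (v : Fin (suc (suc m))) → v ∈ endpoints S
feasible⇒covers {S = S} feasible v with crossing≥1⇒∃ ⁅ v ⁆ (edges S) (feasible⇒crossing-⁅⁆≥1 feasible v)
... | e , e∈S , e-cuts with ∈-map⁻ linkEdge e∈S
... | l , l∈S , refl with xor⇒⊎ e-cuts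
... | inj₁ t = ∈-++⁺ˡ (subst (_∈ map (proj₁ ∘ linkEdge) S) (T-lookup-⁅⁆ v _ t) (∈-map⁺ _ l∈S))
... | inj₂ t = ∈-++⁺ʳ _ (subst (_∈ map (proj₂ ∘ linkEdge) S) (T-lookup-⁅⁆ v _ t) (∈-map⁺ _ l∈S))

feasible⇒n≤2*length : {S : List (Link (suc (suc m)))} → Feasible _ S → suc (suc m) ≤ 2 * length S
feasible⇒n≤2*length {m} {S} feasible = begin
  suc (suc m)                   ≡⟨ sym (length-tabulate {n = suc (suc m)} (λ i → i)) ⟩
  length (allFin (suc (suc m))) ≤⟨ Unique∧⊆⇒length≤ (allFin⁺ _) (λ {v} _ → feasible⇒covers feasible v) ⟩
  length (endpoints S)          ≡⟨ length-endpoints S ⟩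
  2 * length S                  ∎
  where open ≤-Reasoning

-- The cycle crosses every proper cut twice, so one crossing link suffices.
feasible-if-dominated : {L O : List (Link (suc m))} →
                        (∀ X → crossing X (edges O) ≡ 0 → crossing X (edges L) ≡ 0) →
                        Feasible _ L → Feasible _ O
feasible-if-dominated {m} {L} {O} dominated feasible X ne-X ne-∁X
  rewrite crossing-++ X (cycleEdges (suc m)) (edges O) with crossing X (edges O) in O-crossing
... | suc _ = +-mono-≤ (cycle-crossing≥2 X ne-X ne-∁X) (s≤s z≤n)
... | zero  = begin
  3                                                ≤⟨ feasible X ne-X ne-∁X ⟩
  crossing X (cycleEdges _ ++ edges L)             ≡⟨ crossing-++ X (cycleEdges _) (edges L) ⟩
  crossing X (cycleEdges _) + crossing X (edges L) ≡⟨ cong (crossing X (cycleEdges _) +_) (dominated X O-crossing) ⟩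
  crossing X (cycleEdges _) + 0                    ∎
  where open ≤-Reasoning

-- Union–find

roots : (Fin n → Fin n) → Subset n
roots c = tabulate (λ w → does (c w ≟ᶠ w))

∈-roots⁺ : {c : Fin n → Fin n} {w : Fin n} → c w ≡ w → w ∈ₛ roots c
∈-roots⁺ {c = c} {w} cw≡w = lookup⇒[]= w (roots c) (trans (lookup∘tabulate _ w) (dec-true (c w ≟ᶠ w) cw≡w))

∈-roots⁻ : {c : Fin n → Fin n} {w : Fin n} → w ∈ₛ roots c → c w ≡ w
∈-roots⁻ {c = c} {w} w∈roots with c w ≟ᶠ w | trans (sym (lookup∘tabulate _ w)) ([]=⇒lookup w∈roots)
... | yes cw≡w | _  = cw≡w
... | no  _    | ()

roots-cong : {c d : Fin n → Fin n} → (∀ w → c w ≡ d w) → roots c ≡ roots d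
roots-cong c≗d = tabulate-cong (λ w → cong (λ x → does (x ≟ᶠ w)) (c≗d w))

relabel : Fin n → Fin n → Fin n → Fin n
relabel a b w with w ≟ᶠ b
... | yes _ = a
... | no  _ = w

relabel-target : (a b : Fin n) → relabel a b b ≡ a
relabel-target a b with b ≟ᶠ b
... | yes _   = refl
... | no  b≢b = ⊥-elim (b≢b refl)

relabel-other : (a : Fin n) {b w : Fin n} → w ≢ b → relabel a b w ≡ w
relabel-other a {b} {w} w≢b with w ≟ᶠ b
... | yes w≡b = ⊥-elim (w≢b w≡b)
... | no  _   = refl

Idempotent : (Fin n → Fin n) → Set
Idempotent c = ∀ w → c (c w) ≡ c w

module _ {c : Fin n → Fin n} (c-idem : Idempotent c) {u v : Fin n} (cu≢cv : c u ≢ c v) where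

  private
    merged : Fin n → Fin n
    merged = relabel (c u) (c v) ∘ c

    merged-joined : ∀ {w} → c w ≡ c v → merged w ≡ c u
    merged-joined cw≡cv = trans (cong (relabel (c u) (c v)) cw≡cv) (relabel-target (c u) (c v))

    merged-other : ∀ {w} → c w ≢ c v → merged w ≡ c w
    merged-other = relabel-other (c u)

  relabel-idempotent : Idempotent merged
  relabel-idempotent w = by-cases (c w ≟ᶠ c v)
    where
    open ≡-Reasoning
    by-cases : Dec (c w ≡ c v) → merged (merged w) ≡ merged w
    by-cases (yes cw≡cv) = begin
      merged (merged w) ≡⟨ cong merged (merged-joined cw≡cv) ⟩
      merged (c u)      ≡⟨ merged-other (λ ccu≡cv → cu≢cv (trans (sym (c-idem u)) ccu≡cv)) ⟩
      c (c u)           ≡⟨ c-idem u ⟩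
      c u               ≡⟨ sym (merged-joined cw≡cv) ⟩
      merged w          ∎
    by-cases (no cw≢cv) = begin
      merged (merged w) ≡⟨ cong merged (merged-other cw≢cv) ⟩
      merged (c w)      ≡⟨ cong (relabel (c u) (c v)) (c-idem w) ⟩
      merged w          ∎

  relabel-roots⊂ : roots merged ⊂ roots c
  relabel-roots⊂ = (λ {w} w∈ → ∈-roots⁺ {c = c} (root-preserved (c w ≟ᶠ c v) (∈-roots⁻ {c = merged} w∈)))
                 , c v
                 , ∈-roots⁺ {c = c} (c-idem v)
                 , cv-demoted
    where
    root-preserved : ∀ {w} → Dec (c w ≡ c v) → merged w ≡ w → c w ≡ w
    root-preserved (no cw≢cv)  merged-w≡w = trans (sym (merged-other cw≢cv)) merged-w≡w
    root-preserved {w} (yes cw≡cv) merged-w≡w = begin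
      c w     ≡⟨ cong c (sym cu≡w) ⟩
      c (c u) ≡⟨ c-idem u ⟩
      c u     ≡⟨ cu≡w ⟩
      w       ∎
      where
      open ≡-Reasoning
      cu≡w = trans (sym (merged-joined cw≡cv)) merged-w≡w
    cv-demoted : c v ∉ₛ roots merged
    cv-demoted cv∈ = cu≢cv (trans (sym (merged-joined (c-idem v))) (∈-roots⁻ {c = merged} cv∈))

  relabel-same-side : (f : Fin n → Bool) → (∀ x y → c x ≡ c y → f x ≡ f y) → f u ≡ f v →
                      ∀ x y → merged x ≡ merged y → f x ≡ f y
  relabel-same-side f c-sides fu≡fv x y = by-cases (c x ≟ᶠ c v) (c y ≟ᶠ c v)
    where
    open ≡-Reasoning
    by-cases : Dec (c x ≡ c v) → Dec (c y ≡ c v) → merged x ≡ merged y → f x ≡ f y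
    by-cases (yes cx≡cv) (yes cy≡cv) _ = c-sides x y (trans cx≡cv (sym cy≡cv))
    by-cases (no  cx≢cv) (no  cy≢cv) m = c-sides x y (trans (sym (merged-other cx≢cv)) (trans m (merged-other cy≢cv)))
    by-cases (yes cx≡cv) (no  cy≢cv) m = begin
      f x ≡⟨ c-sides x v cx≡cv ⟩
      f v ≡⟨ sym fu≡fv ⟩
      f u ≡⟨ c-sides u y (trans (sym (merged-joined cx≡cv)) (trans m (merged-other cy≢cv))) ⟩
      f y ∎
    by-cases (no  cx≢cv) (yes cy≡cv) m = begin
      f x ≡⟨ c-sides x u (trans (sym (merged-other cx≢cv)) (trans m (merged-joined cy≡cv))) ⟩
      f u ≡⟨ fu≡fv ⟩
      f v ≡⟨ c-sides v y (sym cy≡cv) ⟩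
      f y ∎

-- c maps each vertex to the root of its component in (V, forest); each forest
-- link merged two components, whence `size`.
record Invariant {n : ℕ} (c : Fin n → Fin n) (forest : List (Link n)) : Set where
  field
    idempotent : Idempotent c
    size       : length forest + ∣ roots c ∣ ≤ n
    same-side  : ∀ X → crossing X (edges forest) ≡ 0 → ∀ x y → c x ≡ c y → lookup X x ≡ lookup X y
open Invariant

invariant-cong : {c d : Fin n → Fin n} {forest : List (Link n)} → (∀ w → c w ≡ d w) →
                 Invariant c forest → Invariant d forest
invariant-cong {n} {c} {d} {forest} c≗d inv = record
  { idempotent = λ w → begin
      d (d w) ≡⟨ sym (c≗d (d w)) ⟩
      c (d w) ≡⟨ cong c (sym (c≗d w)) ⟩
      c (c w) ≡⟨ idempotent inv w ⟩
      c w     ≡⟨ c≗d w ⟩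
      d w     ∎
  ; size      = subst (λ r → length forest + ∣ r ∣ ≤ n) (roots-cong c≗d) (size inv)
  ; same-side = λ X no-crossing x y dx≡dy →
      same-side inv X no-crossing x y (trans (c≗d x) (trans dx≡dy (sym (c≗d y))))
  }
  where open ≡-Reasoning

invariant-initial : Invariant {n} (λ w → w) []
invariant-initial = record
  { idempotent = λ _ → refl
  ; size       = ∣p∣≤n (roots (λ w → w))
  ; same-side  = λ X _ _ _ → cong (lookup X)
  }

invariant-merge : {c : Fin n → Fin n} {forest : List (Link n)} → Invariant c forest →
                  (((u , v) , u<v) : Link n) → c u ≢ c v →
                  Invariant (relabel (c u) (c v) ∘ c) (((u , v) , u<v) ∷ forest)
invariant-merge {n} {c} {forest} inv ((u , v) , _) cu≢cv = record
  { idempotent = relabel-idempotent (idempotent inv) cu≢cv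
  ; size       = begin
      suc (length forest) + ∣ roots (relabel (c u) (c v) ∘ c) ∣
        ≡⟨ sym (+-suc (length forest) _) ⟩
      length forest + suc ∣ roots (relabel (c u) (c v) ∘ c) ∣
        ≤⟨ +-monoʳ-≤ (length forest) (p⊂q⇒∣p∣<∣q∣ (relabel-roots⊂ (idempotent inv) cu≢cv)) ⟩
      length forest + ∣ roots c ∣
        ≤⟨ size inv ⟩
      n ∎
  ; same-side  = λ X no-crossing →
      let Xu≡Xv , no-forest-crossing = crossing-∷≡0 X (u , v) (edges forest) no-crossing in
      relabel-same-side (idempotent inv) cu≢cv (lookup X) (same-side inv X no-forest-crossing) Xu≡Xv
  }
  where open ≤-Reasoning

-- rep is a vector rather than a function so that decode (encode s) ≡ s holds on the nose.
record State (n : ℕ) : Set where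
  constructor state
  field
    rep    : Vec (Fin n) n
    forest : List (Link n)
open State

record WellFormed {n : ℕ} (s : State n) : Set where
  constructor wellFormed
  field invariant : Invariant (lookup (rep s)) (forest s)
open WellFormed

Spans : State n → Link n → Set
Spans s ((u , v) , _) = lookup (rep s) u ≡ lookup (rep s) v

initial : (n : ℕ) → State n
initial n = state (Vec.allFin n) []

merge : State n → Link n → State n
merge s l@((u , v) , _) = state (Vec.map (relabel (lookup (rep s) u) (lookup (rep s) v)) (rep s)) (l ∷ forest s)

insert : State n → Link n → State n
insert s ((u , v) , u<v) with lookup (rep s) u ≟ᶠ lookup (rep s) v
... | yes _ = s
... | no  _ = merge s ((u , v) , u<v)

wellFormed-initial : WellFormed (initial n)
wellFormed-initial = wellFormed (invariant-cong (λ w → sym (lookup-allFin w)) invariant-initial)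

insert-wellFormed : {s : State n} → WellFormed s → (l : Link n) → WellFormed (insert s l)
insert-wellFormed {s = s} wf ((u , v) , u<v) with lookup (rep s) u ≟ᶠ lookup (rep s) v
... | yes _     = wf
... | no  ru≢rv =
  wellFormed (invariant-cong (λ w → sym (lookup-map w _ (rep s)))
                             (invariant-merge (invariant wf) ((u , v) , u<v) ru≢rv))

insert-spans : (s : State n) (l : Link n) → Spans (insert s l) l
insert-spans s ((u , v) , u<v) with lookup (rep s) u ≟ᶠ lookup (rep s) v
... | yes ru≡rv = ru≡rv
... | no  ru≢rv = begin
  lookup (Vec.map merged (rep s)) u ≡⟨ lookup-map u merged (rep s) ⟩
  merged (lookup (rep s) u)         ≡⟨ relabel-other _ ru≢rv ⟩
  lookup (rep s) u                  ≡⟨ sym (relabel-target _ (lookup (rep s) v)) ⟩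
  merged (lookup (rep s) v)         ≡⟨ sym (lookup-map v merged (rep s)) ⟩
  lookup (Vec.map merged (rep s)) v ∎
  where
  open ≡-Reasoning
  merged = relabel (lookup (rep s) u) (lookup (rep s) v)

insert-preserves-spans : (s : State n) (l l′ : Link n) → Spans s l′ → Spans (insert s l) l′
insert-preserves-spans s ((u , v) , u<v) ((u′ , v′) , _) spans with lookup (rep s) u ≟ᶠ lookup (rep s) v
... | yes _ = spans
... | no  _ = trans (lookup-map u′ _ (rep s)) (trans (cong (relabel _ _) spans) (sym (lookup-map v′ _ (rep s))))

insert-forest : (s : State n) (l : Link n) {L : List (Link n)} → forest s ⊆ˡ L → l ∈ L →
                forest (insert s l) ⊆ˡ L
insert-forest s ((u , v) , u<v) forest⊆L l∈L with lookup (rep s) u ≟ᶠ lookup (rep s) v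
... | yes _ = forest⊆L
... | no  _ = l∈L ∷ forest⊆L

insertAll : State n → List (Link n) → State n
insertAll = foldl insert

insertAll-wellFormed : {s : State n} → WellFormed s → (ls : List (Link n)) → WellFormed (insertAll s ls)
insertAll-wellFormed wf []       = wf
insertAll-wellFormed wf (l ∷ ls) = insertAll-wellFormed (insert-wellFormed wf l) ls

insertAll-preserves-spans : (s : State n) (ls : List (Link n)) (l′ : Link n) →
                            Spans s l′ → Spans (insertAll s ls) l′
insertAll-preserves-spans s []       _  spans = spans
insertAll-preserves-spans s (l ∷ ls) l′ spans =
  insertAll-preserves-spans (insert s l) ls l′ (insert-preserves-spans s l l′ spans)

insertAll-spans : (s : State n) (ls : List (Link n)) → All (Spans (insertAll s ls)) ls
insertAll-spans s []       = []
insertAll-spans s (l ∷ ls) =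
  insertAll-preserves-spans (insert s l) ls l (insert-spans s l) ∷ insertAll-spans (insert s l) ls

insertAll-forest : (s : State n) {L : List (Link n)} (ls : List (Link n)) → forest s ⊆ˡ L → ls ⊆ˡ L →
                   forest (insertAll s ls) ⊆ˡ L
insertAll-forest s []       forest⊆L _              = forest⊆L
insertAll-forest s (l ∷ ls) forest⊆L (l∈L ∷ ls⊆L) =
  insertAll-forest (insert s l) ls (insert-forest s l forest⊆L l∈L) ls⊆L

forest-dominates : {s : State n} → WellFormed s → (L : List (Link n)) → All (Spans s) L →
                   ∀ X → crossing X (edges (forest s)) ≡ 0 → crossing X (edges L) ≡ 0
forest-dominates wf [] _ X _ = refl
forest-dominates wf (((u , v) , _) ∷ L) (spans ∷ spans-L) X no-crossing with lookup X u xor lookup X v in uv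
... | true  = ⊥-elim (xor-≡ (same-side (invariant wf) X no-crossing u v spans) (subst T (sym uv) _))
... | false = forest-dominates wf L spans-L X no-crossing

forest-length≤n : {s : State n} → WellFormed s → length (forest s) ≤ n
forest-length≤n wf = ≤-trans (m≤m+n _ _) (size (invariant wf))

-- The streaming algorithm

repAt : Memory n → Fin n → Fin n
repAt []            w = w
repAt ((x , r) ∷ m) w with x ≟ᶠ w
... | yes _ = r
... | no  _ = repAt m w

toLink : Edge n → Maybe (Link n)
toLink (u , v) with toℕ u <? toℕ v
... | yes u<v = just ((u , v) , u<v)
... | no  _   = nothing

-- Memory layout: the cells (w , representative of w) for every vertex w,
-- followed by the forest links.
table : Vec (Fin n) n → Memory n
table {n} r = map (λ w → w , lookup r w) (allFin n)

encode : State n → Memory n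
encode s = table (rep s) ++ edges (forest s)

decode : Memory n → State n
decode {n} m = state (tabulate (repAt m)) (mapMaybe toLink (drop n m))

repAt-table : (f : Fin n → Fin n) (xs : List (Fin n)) (rest : Memory n) {w : Fin n} → w ∈ xs →
              repAt (map (λ x → x , f x) xs ++ rest) w ≡ f w
repAt-table f (x ∷ xs) rest {w} w∈ with x ≟ᶠ w | w∈
... | yes refl | _          = refl
... | no  x≢w  | here w≡x   = ⊥-elim (x≢w (sym w≡x))
... | no  _    | there w∈xs = repAt-table f xs rest w∈xs

toLink-linkEdge : (l : Link n) → toLink (linkEdge l) ≡ just l
toLink-linkEdge ((u , v) , u<v) with toℕ u <? toℕ v
... | yes u<v′ = cong (λ p → just ((u , v) , p)) (<-irrelevant u<v′ u<v)
... | no  u≮v  = ⊥-elim (u≮v u<v)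

length-table : (r : Vec (Fin n) n) → length (table r) ≡ n
length-table {n} r = trans (length-map _ (allFin n)) (length-tabulate {n = n} (λ i → i))

decode-encode : (s : State n) → decode (encode s) ≡ s
decode-encode {n} (state r o) = cong₂ state rep-decoded forest-decoded
  where
  open ≡-Reasoning
  rep-decoded : tabulate (repAt (encode (state r o))) ≡ r
  rep-decoded = begin
    tabulate (repAt (encode (state r o)))
      ≡⟨ tabulate-cong (λ w → repAt-table (lookup r) (allFin n) (edges o) (∈-allFin w)) ⟩
    tabulate (lookup r)
      ≡⟨ tabulate∘lookup r ⟩
    r ∎
  forest-decoded : mapMaybe toLink (drop n (encode (state r o))) ≡ o
  forest-decoded = begin
    mapMaybe toLink (drop n (table r ++ edges o))
      ≡⟨ cong (λ k → mapMaybe toLink (drop k (table r ++ edges o))) (sym (length-table r)) ⟩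
    mapMaybe toLink (drop (length (table r)) (table r ++ edges o))
      ≡⟨ cong (mapMaybe toLink) (drop-++ (table r) (edges o)) ⟩
    mapMaybe toLink (edges o)
      ≡⟨ mapMaybe-map-retract toLink-linkEdge o ⟩
    o ∎

length-encode : (s : State n) → length (encode s) ≡ n + length (forest s)
length-encode s = trans (length-++ (table (rep s))) (cong₂ _+_ (length-table (rep s)) (length-map linkEdge (forest s)))

encode-bounded : {s : State n} → WellFormed s → length (encode s) ≤ 2 * n
encode-bounded {n} {s} wf = begin
  length (encode s)       ≡⟨ length-encode s ⟩
  n + length (forest s)   ≤⟨ +-monoʳ-≤ n (forest-length≤n wf) ⟩
  n + n                   ≡⟨ cong (n +_) (sym (+-identityʳ n)) ⟩
  2 * n                   ∎
  where open ≤-Reasoning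

unionFind : StreamAlg
unionFind = record
  { init   = λ n → encode (initial n)
  ; step   = λ n m l → encode (insert (decode m) l)
  ; output = λ n m → forest (decode m)
  }

run-encode : (s : State n) (ls : List (Link n)) → foldl (step unionFind n) (encode s) ls ≡ encode (insertAll s ls)
run-encode s []       = refl
run-encode {n} s (l ∷ ls) =
  trans (cong (λ t → foldl (step unionFind n) (encode (insert t l)) ls) (decode-encode s)) (run-encode (insert s l) ls)

output-run : (L : List (Link n)) → output unionFind n (run unionFind n L) ≡ forest (insertAll (initial n) L)
output-run {n} L = begin
  forest (decode (run unionFind n L))              ≡⟨ cong (forest ∘ decode) (run-encode (initial n) L) ⟩
  forest (decode (encode (insertAll (initial n) L))) ≡⟨ cong forest (decode-encode (insertAll (initial n) L)) ⟩
  forest (insertAll (initial n) L)                 ∎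
  where open ≡-Reasoning

states-bounded : {s : State n} → WellFormed s → (ls : List (Link n)) →
                 All (λ m → length m ≤ 2 * n) (states unionFind n (encode s) ls)
states-bounded wf [] = encode-bounded wf ∷ []
states-bounded {n} {s} wf (l ∷ ls) =
  encode-bounded wf ∷ subst (λ t → All (λ m → length m ≤ 2 * n) (states unionFind n (encode (insert t l)) ls))
                            (sym (decode-encode s)) (states-bounded (insert-wellFormed wf l) ls)

unionFind-memory : (L : List (Link n)) → MemoryBound unionFind 2 n L
unionFind-memory L = states-bounded wellFormed-initial L

unionFind-output⊆ : (L : List (Link n)) → output unionFind n (run unionFind n L) ⊆ˡ L
unionFind-output⊆ {n} L =
  subst (_⊆ˡ L) (sym (output-run L)) (insertAll-forest (initial n) L [] (All.tabulate (λ l∈L → l∈L)))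

unionFind-feasible : {L : List (Link (suc m))} → Feasible _ L → Feasible _ (output unionFind _ (run unionFind _ L))
unionFind-feasible {m} {L} feasible = subst (Feasible _) (sym (output-run L))
  (feasible-if-dominated (forest-dominates (insertAll-wellFormed wellFormed-initial L) L
                                           (insertAll-spans (initial (suc m)) L))
                         feasible)

unionFind-2-approximation : (L : List (Link (suc (suc m)))) {S : List (Link (suc (suc m)))} → Feasible _ S →
                            length (output unionFind _ (run unionFind _ L)) ≤ 2 * length S
unionFind-2-approximation {m} L {S} feasible = subst (_≤ 2 * length S) (sym (cong length (output-run L))) (begin
  length (forest (insertAll (initial (suc (suc m))) L)) ≤⟨ forest-length≤n (insertAll-wellFormed wellFormed-initial L) ⟩
  suc (suc m)                                         ≤⟨ feasible⇒n≤2*length feasible ⟩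
  2 * length S                                        ∎)
  where open ≤-Reasoning

mainTheorem2 : Σ StreamAlg λ A → Σ ℕ λ c →
      ((n : ℕ) → 3 ≤ n → (L : List (Link n)) → Unique L →
         MemoryBound A c n L
         × (Feasible n L →
              output A n (run A n L) ⊆ˡ L
              × Feasible n (output A n (run A n L))
              × ((S′ : List (Link n)) → S′ ⊆ˡ L → Feasible n S′ →
                   length (output A n (run A n L)) ≤ 2 * length S′)))
mainTheorem2 = unionFind , 2 , λ where
  (suc (suc _)) (s≤s (s≤s _)) L _ →
    unionFind-memory L , λ feasible →
      unionFind-output⊆ L , unionFind-feasible feasible , λ _ _ → unionFind-2-approximation L
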